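{- Let $(F_n)_{n\ge 0}$ be the Fibonacci sequence, $F_0=0$, $F_1=1$, $F_n=F_{n-1}+F_{n-2}$ for $n\ge 2$, and let $N$ be a fixed positive integer. If $F$ is a Fibonacci number and there exists an integer $d$ with $0\le d\le 10^N-1$ such that $10^NF+d$ is a Fibonacci number, then $$F\le \tfrac{8}{7}\,(10^N-1).$$ Consequently, there is no infinite sequence $a_1,a_2,\dots$ of positive Fibonacci numbers such that for every $i$ there is an integer $d_i$ with $0\le d_i\le 10^N-1$ and $a_{i+1}=10^Na_i+d_i$ (i.e., one cannot walk to infinity on the Fibonacci numbers by appending exactly $N$ digits, leading zeros allowed, to the right at each step).
   Context: Appending exactly $N$ digits to a number $a$ means forming $10^N a+d$ with $0\le d\le 10^N-1$ (leading zeros in the appended block allowed). -}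

module Defs where

open import Data.Nat using (ℕ; zero; suc; _+_)
open import Data.Product using (∃)
open import Relation.Binary.PropositionalEquality using (_≡_)

fib : ℕ → ℕ
fib zero = 0
fib (suc zero) = 1
fib (suc (suc n)) = fib (suc n) + fib n

IsFib : ℕ → Set
IsFib m = ∃ λ k → fib k ≡ m

-- Write the larger Fibonacci number as F_{k+j} = M F_k + d with M = 10^N and F = F_k.
-- For j ≤ 4, F_{k+j} ≤ 8F < M F.  For j ≥ k, the addition formula gives
-- F_j F_{k+1} ≤ F_{k+j} < M F_{k+1}, so F ≤ F_j < M.  For 5 ≤ j < k, put k = r + j: the
-- identity F_{k+j} + (-1)ʲ F_r = L_j F_k places F_{k+j} within F_r ≤ F/8 of L_j F, and
-- L_j ≠ M because 5 never divides a Lucas number; comparing L_j F with M F then gives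
-- F ≤ d + F_r, hence 7F ≤ 8d.  A walk strictly increases, so it cannot stay below 8(M-1)/7.
module Submission where

open import Defs
open import Data.Nat
open import Data.Nat.Properties
open import Data.Nat.Divisibility using (_∣_; _∣?_; divides; ∣-trans; ∣m+n∣m⇒∣n; m∣m*n)
open import Data.Nat.Tactic.RingSolver using (solve-∀)
open import Data.Product using (∃; _×_; _,_; proj₁; proj₂)
open import Function using (_∘_)
open import Relation.Binary.Definitions using (tri<; tri≈; tri>)
open import Relation.Binary.PropositionalEquality
open import Relation.Nullary using (¬_; yes; no; contradiction)
open import Relation.Nullary.Decidable using (from-no)

fib-+ : ∀ m n → fib (suc (m + n)) ≡ fib (suc m) * fib (suc n) + fib m * fib n
fib-+ zero n = sym (trans (+-identityʳ _) (+-identityʳ _))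
fib-+ (suc zero) n = cong₂ _+_ (sym (+-identityʳ (fib (suc n)))) (sym (+-identityʳ (fib n)))
fib-+ (suc (suc m)) n = begin
    fib (suc (suc (m + n))) + fib (suc (m + n))
  ≡⟨ cong₂ _+_ (fib-+ (suc m) n) (fib-+ m n) ⟩
    (fib (2 + m) * fib (suc n) + fib (1 + m) * fib n) + (fib (1 + m) * fib (suc n) + fib m * fib n)
  ≡⟨ regroup (fib (2 + m)) (fib (1 + m)) (fib m) (fib (suc n)) (fib n) ⟩
    (fib (2 + m) + fib (1 + m)) * fib (suc n) + (fib (1 + m) + fib m) * fib n
  ∎
  where
    open ≡-Reasoning
    regroup : ∀ a b c x y → (a * x + b * y) + (b * x + c * y) ≡ (a + b) * x + (b + c) * y
    regroup = solve-∀

fib-≤-suc : ∀ n → fib n ≤ fib (suc n)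
fib-≤-suc zero = z≤n
fib-≤-suc (suc n) = m≤m+n _ _

fib-mono-≤ : ∀ {m n} → m ≤ n → fib m ≤ fib n
fib-mono-≤ {m} {n} m≤n = subst (λ k → fib m ≤ fib k) (m∸n+n≡m m≤n) (go (n ∸ m))
  where
    go : ∀ t → fib m ≤ fib (t + m)
    go zero = ≤-refl
    go (suc t) = ≤-trans (go t) (fib-≤-suc (t + m))

fib-suc>0 : ∀ n → 0 < fib (suc n)
fib-suc>0 zero = ≤-refl
fib-suc>0 (suc n) = ≤-trans (fib-suc>0 n) (m≤m+n _ _)

fib[n]*fib[1+m]≤fib[m+n] : ∀ m n → fib n * fib (suc m) ≤ fib (m + n)
fib[n]*fib[1+m]≤fib[m+n] m zero = z≤n
fib[n]*fib[1+m]≤fib[m+n] m (suc n) = begin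
    fib (suc n) * fib (suc m)               ≤⟨ m≤m+n _ _ ⟩
    fib (suc n) * fib (suc m) + fib n * fib m ≡⟨ sym (fib-+ n m) ⟩
    fib (suc (n + m))                       ≡⟨ cong fib (sym (trans (+-suc m n) (cong suc (+-comm m n)))) ⟩
    fib (m + suc n)                         ∎
  where open ≤-Reasoning

fib[5+n]≡5*fib[1+n]+3*fib[n] : ∀ n → fib (5 + n) ≡ 5 * fib (1 + n) + 3 * fib n
fib[5+n]≡5*fib[1+n]+3*fib[n] n = unfolded (fib (1 + n)) (fib n)
  where
    unfolded : ∀ a b → (((a + b) + a) + (a + b)) + ((a + b) + a) ≡ 5 * a + 3 * b
    unfolded = solve-∀

8*fib[n]≤fib[5+n] : ∀ n → 8 * fib n ≤ fib (5 + n)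
8*fib[n]≤fib[5+n] n = begin
    8 * fib n                       ≡⟨ *-distribʳ-+ (fib n) 5 3 ⟩
    5 * fib n + 3 * fib n           ≤⟨ +-monoˡ-≤ (3 * fib n) (*-monoʳ-≤ 5 (fib-≤-suc n)) ⟩
    5 * fib (1 + n) + 3 * fib n     ≡⟨ sym (fib[5+n]≡5*fib[1+n]+3*fib[n] n) ⟩
    fib (5 + n)                     ∎
  where open ≤-Reasoning

fib[5+n]≤8*fib[1+n] : ∀ n → fib (5 + n) ≤ 8 * fib (1 + n)
fib[5+n]≤8*fib[1+n] n = begin
    fib (5 + n)                     ≡⟨ fib[5+n]≡5*fib[1+n]+3*fib[n] n ⟩
    5 * fib (1 + n) + 3 * fib n     ≤⟨ +-monoʳ-≤ (5 * fib (1 + n)) (*-monoʳ-≤ 3 (fib-≤-suc n)) ⟩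
    5 * fib (1 + n) + 3 * fib (1 + n) ≡⟨ *-distribʳ-+ (fib (1 + n)) 5 3 ⟨
    8 * fib (1 + n)                 ∎
  where open ≤-Reasoning

χeven : ℕ → ℕ
χeven zero = 1
χeven (suc zero) = 0
χeven (suc (suc n)) = χeven n

χodd : ℕ → ℕ
χodd n = χeven (suc n)

χeven≤1 : ∀ n → χeven n ≤ 1
χeven≤1 zero = ≤-refl
χeven≤1 (suc zero) = z≤n
χeven≤1 (suc (suc n)) = χeven≤1 n

cassini : ∀ n → fib n * fib (2 + n) + χeven n ≡ fib (1 + n) * fib (1 + n) + χodd n
cassini zero = refl
cassini (suc n) = begin
    fib (1 + n) * (fib (2 + n) + fib (1 + n)) + χodd n
  ≡⟨ expand (fib (1 + n)) (fib (2 + n)) (χodd n) ⟩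
    fib (1 + n) * fib (2 + n) + (fib (1 + n) * fib (1 + n) + χodd n)
  ≡⟨ cong (fib (1 + n) * fib (2 + n) +_) (cassini n) ⟨
    fib (1 + n) * fib (2 + n) + (fib n * fib (2 + n) + χeven n)
  ≡⟨ collect (fib (1 + n)) (fib (2 + n)) (fib n) (χeven n) ⟩
    fib (2 + n) * fib (2 + n) + χeven n
  ∎
  where
    open ≡-Reasoning
    expand : ∀ a b o → a * (b + a) + o ≡ a * b + (a * a + o)
    expand = solve-∀
    collect : ∀ a b c e → a * b + (c * b + e) ≡ b * (a + c) + e
    collect = solve-∀

lucas : ℕ → ℕ
lucas zero = 2
lucas (suc n) = fib (2 + n) + fib n

lucas[n]*fib[n]≡fib[n+n] : ∀ n → lucas n * fib n ≡ fib (n + n)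
lucas[n]*fib[n]≡fib[n+n] zero = refl
lucas[n]*fib[n]≡fib[n+n] (suc n) = begin
    (fib (2 + n) + fib n) * fib (1 + n)
  ≡⟨ distrib (fib (2 + n)) (fib n) (fib (1 + n)) ⟩
    fib (2 + n) * fib (1 + n) + fib (1 + n) * fib n
  ≡⟨ fib-+ (suc n) n ⟨
    fib (suc (suc n + n))
  ≡⟨ cong (fib ∘ suc) (+-suc n n) ⟨
    fib (suc n + suc n)
  ∎
  where
    open ≡-Reasoning
    distrib : ∀ a b c → (a + b) * c ≡ a * c + c * b
    distrib = solve-∀

lucas[n]*fib[1+n] : ∀ n → lucas n * fib (1 + n) + χodd n ≡ fib (1 + n + n) + χeven n
lucas[n]*fib[1+n] zero = refl
lucas[n]*fib[1+n] (suc n) = begin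
    (fib (2 + n) + fib n) * fib (2 + n) + χeven n
  ≡⟨ expand (fib (2 + n)) (fib n) (χeven n) ⟩
    fib (2 + n) * fib (2 + n) + (fib n * fib (2 + n) + χeven n)
  ≡⟨ cong (fib (2 + n) * fib (2 + n) +_) (cassini n) ⟩
    fib (2 + n) * fib (2 + n) + (fib (1 + n) * fib (1 + n) + χodd n)
  ≡⟨ +-assoc (fib (2 + n) * fib (2 + n)) _ (χodd n) ⟨
    (fib (2 + n) * fib (2 + n) + fib (1 + n) * fib (1 + n)) + χodd n
  ≡⟨ cong (_+ χodd n) (fib-+ (suc n) (suc n)) ⟨
    fib (suc (suc n + suc n)) + χodd n
  ∎
  where
    open ≡-Reasoning
    expand : ∀ b a e → (b + a) * b + e ≡ b * b + (a * b + e)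
    expand = solve-∀

-- Fₙ₊ⱼ + (-1)ʲ Fₙ₋ⱼ = Lⱼ Fₙ, written for n = r + j with the sign moved across.
lucas-fib : ∀ r j → lucas j * fib (r + j) + fib r * χodd j ≡ fib (r + j + j) + fib r * χeven j
lucas-fib zero j = cong (_+ 0) (lucas[n]*fib[n]≡fib[n+n] j)
lucas-fib (suc zero) j rewrite *-identityˡ (χodd j) | *-identityˡ (χeven j) = lucas[n]*fib[1+n] j
lucas-fib (suc (suc r)) j = begin
    L * (fib (suc (r + j)) + fib (r + j)) + (fib (suc r) + fib r) * o
  ≡⟨ split L (fib (suc (r + j))) (fib (r + j)) (fib (suc r)) (fib r) o ⟩
    (L * fib (suc (r + j)) + fib (suc r) * o) + (L * fib (r + j) + fib r * o)
  ≡⟨ cong₂ _+_ (lucas-fib (suc r) j) (lucas-fib r j) ⟩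
    (fib (suc (r + j + j)) + fib (suc r) * e) + (fib (r + j + j) + fib r * e)
  ≡⟨ split′ (fib (suc (r + j + j))) (fib (r + j + j)) (fib (suc r)) (fib r) e ⟩
    (fib (suc (r + j + j)) + fib (r + j + j)) + (fib (suc r) + fib r) * e
  ∎
  where
    open ≡-Reasoning
    L = lucas j
    o = χodd j
    e = χeven j
    split : ∀ l a b c d x → l * (a + b) + (c + d) * x ≡ (l * a + c * x) + (l * b + d * x)
    split = solve-∀
    split′ : ∀ a b c d x → (a + c * x) + (b + d * x) ≡ (a + b) + (c + d) * x
    split′ = solve-∀

fib-near-lucas-multiple : ∀ r j →
  fib (r + j + j) ≤ lucas j * fib (r + j) + fib r × lucas j * fib (r + j) ≤ fib (r + j + j) + fib r
fib-near-lucas-multiple r j = upper , lower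
  where
    open ≤-Reasoning
    fib[r]*χ≤fib[r] : ∀ n → fib r * χeven n ≤ fib r
    fib[r]*χ≤fib[r] n = ≤-trans (*-monoʳ-≤ (fib r) (χeven≤1 n)) (≤-reflexive (*-identityʳ (fib r)))
    upper : fib (r + j + j) ≤ lucas j * fib (r + j) + fib r
    upper = begin
      fib (r + j + j)                                ≤⟨ m≤m+n _ _ ⟩
      fib (r + j + j) + fib r * χeven j              ≡⟨ lucas-fib r j ⟨
      lucas j * fib (r + j) + fib r * χodd j         ≤⟨ +-monoʳ-≤ _ (fib[r]*χ≤fib[r] (suc j)) ⟩
      lucas j * fib (r + j) + fib r                  ∎
    lower : lucas j * fib (r + j) ≤ fib (r + j + j) + fib r
    lower = begin
      lucas j * fib (r + j)                          ≤⟨ m≤m+n _ _ ⟩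
      lucas j * fib (r + j) + fib r * χodd j         ≡⟨ lucas-fib r j ⟩
      fib (r + j + j) + fib r * χeven j              ≤⟨ +-monoʳ-≤ _ (fib[r]*χ≤fib[r] j) ⟩
      fib (r + j + j) + fib r                        ∎

lucas[4+n]≡5*fib[2+n]+lucas[n] : ∀ n → lucas (4 + n) ≡ 5 * fib (2 + n) + lucas n
lucas[4+n]≡5*fib[2+n]+lucas[n] zero = refl
lucas[4+n]≡5*fib[2+n]+lucas[n] (suc n) = unfolded (fib (1 + n)) (fib n)
  where
    unfolded : ∀ a b →
      ((((((a + b) + a) + (a + b)) + ((a + b) + a)) + (((a + b) + a) + (a + b)))
        + (((a + b) + a) + (a + b)))
      ≡ 5 * ((a + b) + a) + ((a + b) + b)
    unfolded = solve-∀

5∤lucas : ∀ n → ¬ 5 ∣ lucas n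
5∤lucas 0 = from-no (5 ∣? 2)
5∤lucas 1 = from-no (5 ∣? 1)
5∤lucas 2 = from-no (5 ∣? 3)
5∤lucas 3 = from-no (5 ∣? 4)
5∤lucas (suc (suc (suc (suc n)))) 5∣L =
  5∤lucas n (∣m+n∣m⇒∣n (subst (5 ∣_) (lucas[4+n]≡5*fib[2+n]+lucas[n] n) 5∣L) (m∣m*n (fib (2 + n))))

m*x≤n*x+c⇒x≤c : ∀ {m n x c} → n < m → m * x ≤ n * x + c → x ≤ c
m*x≤n*x+c⇒x≤c {m} {n} {x} {c} n<m m*x≤n*x+c = +-cancelˡ-≤ (n * x) x c (begin
    n * x + x  ≡⟨ +-comm (n * x) x ⟩
    suc n * x  ≤⟨ *-monoˡ-≤ x n<m ⟩
    m * x      ≤⟨ m*x≤n*x+c ⟩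
    n * x + c  ∎)
  where open ≤-Reasoning

7*x≤8*d : ∀ {x d e} → x ≤ d + e → 8 * e ≤ x → 7 * x ≤ 8 * d
7*x≤8*d {x} {d} {e} x≤d+e 8*e≤x = +-cancelʳ-≤ x (7 * x) (8 * d) (begin
    7 * x + x       ≡⟨ +-comm (7 * x) x ⟩
    8 * x           ≤⟨ *-monoʳ-≤ 8 x≤d+e ⟩
    8 * (d + e)     ≡⟨ *-distribˡ-+ 8 d e ⟩
    8 * d + 8 * e   ≤⟨ +-monoʳ-≤ (8 * d) 8*e≤x ⟩
    8 * d + x       ∎)
  where open ≤-Reasoning

short-jump : ∀ {M k m d} → 10 ≤ M → m ≤ 4 + k → fib m ≡ M * fib k + d → fib k ≡ 0
short-jump {k = zero} _ _ _ = refl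
short-jump {M} {suc k} {m} {d} 10≤M m≤4+k eq =
  contradiction (*-cancelʳ-≤ 10 8 (fib (suc k)) {{>-nonZero (fib-suc>0 k)}} 10*F≤8*F) (from-no (10 ≤? 8))
  where
    open ≤-Reasoning
    10*F≤8*F : 10 * fib (suc k) ≤ 8 * fib (suc k)
    10*F≤8*F = begin
      10 * fib (suc k)      ≤⟨ *-monoˡ-≤ (fib (suc k)) 10≤M ⟩
      M * fib (suc k)       ≤⟨ m≤m+n _ d ⟩
      M * fib (suc k) + d   ≡⟨ eq ⟨
      fib m                 ≤⟨ fib-mono-≤ m≤4+k ⟩
      fib (5 + k)           ≤⟨ fib[5+n]≤8*fib[1+n] k ⟩
      8 * fib (suc k)       ∎

long-jump : ∀ {M k j d} → 1 < M → d < M → k ≤ j → fib (k + j) ≡ M * fib k + d → fib k < M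
long-jump {k = zero} 1<M _ _ _ = <-trans z<s 1<M
long-jump {k = suc zero} 1<M _ _ _ = 1<M
long-jump {M} {k@(suc (suc k′))} {j} {d} _ d<M k≤j eq =
  ≤-<-trans (fib-mono-≤ k≤j) (*-cancelʳ-< (fib (suc k)) (fib j) M fib[j]*A<M*A)
  where
    open ≤-Reasoning
    fib[j]*A<M*A : fib j * fib (suc k) < M * fib (suc k)
    fib[j]*A<M*A = begin-strict
      fib j * fib (suc k)     ≤⟨ fib[n]*fib[1+m]≤fib[m+n] k j ⟩
      fib (k + j)             ≡⟨ eq ⟩
      M * fib k + d           <⟨ +-monoʳ-< (M * fib k) d<M ⟩
      M * fib k + M           ≡⟨ +-comm (M * fib k) M ⟩
      M + M * fib k           ≡⟨ *-suc M (fib k) ⟨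
      M * suc (fib k)         ≤⟨ *-monoʳ-≤ M (m<m+n (fib k) (fib-suc>0 k′)) ⟩
      M * fib (suc k)         ∎

medium-jump : ∀ {M r j d} → 5 ∣ M → 5 ≤ j →
  fib (r + j + j) ≡ M * fib (r + j) + d → 7 * fib (r + j) ≤ 8 * d
medium-jump {M} {r} {j} {d} 5∣M 5≤j eq = 7*x≤8*d {d = d} {e = e} F≤d+e 8*e≤F
  where
    open ≤-Reasoning
    F = fib (r + j)
    e = fib r
    L = lucas j
    8*e≤F : 8 * e ≤ F
    8*e≤F = ≤-trans (8*fib[n]≤fib[5+n] r) (fib-mono-≤ (subst (_≤ r + j) (+-comm r 5) (+-monoʳ-≤ r 5≤j)))
    F≤d+e : F ≤ d + e
    F≤d+e with <-cmp L M
    ... | tri< L<M _ _ = ≤-trans (m*x≤n*x+c⇒x≤c L<M (begin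
            M * F            ≤⟨ m≤m+n (M * F) d ⟩
            M * F + d        ≡⟨ eq ⟨
            fib (r + j + j)  ≤⟨ proj₁ (fib-near-lucas-multiple r j) ⟩
            L * F + e        ∎)) (m≤n+m e d)
    ... | tri≈ _ L≡M _ = contradiction (subst (5 ∣_) (sym L≡M) 5∣M) (5∤lucas j)
    ... | tri> _ _ M<L = m*x≤n*x+c⇒x≤c M<L (begin
            L * F                ≤⟨ proj₂ (fib-near-lucas-multiple r j) ⟩
            fib (r + j + j) + e  ≡⟨ cong (_+ e) eq ⟩
            M * F + d + e        ≡⟨ +-assoc (M * F) d e ⟩
            M * F + (d + e)      ∎)

jump-bound : ∀ {M′ k j d} → 10 ≤ suc M′ → 5 ∣ suc M′ → d ≤ M′ → 5 ≤ j →
  fib (k + j) ≡ suc M′ * fib k + d → 7 * fib k ≤ 8 * M′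
jump-bound {M′} {k} {j} {d} 10≤M 5∣M d≤M′ 5≤j eq with k ≤? j
... | yes k≤j = *-mono-≤ (n≤1+n 7) (s≤s⁻¹ (long-jump (≤-trans (s≤s (s≤s z≤n)) 10≤M) (s≤s d≤M′) k≤j eq))
... | no k≰j = ≤-trans (subst (λ n → 7 * fib n ≤ 8 * d) r+j≡k (medium-jump {r = k ∸ j} 5∣M 5≤j eq′)) (*-monoʳ-≤ 8 d≤M′)
  where
    r+j≡k : k ∸ j + j ≡ k
    r+j≡k = m∸n+n≡m (<⇒≤ (≰⇒> k≰j))
    eq′ : fib (k ∸ j + j + j) ≡ suc M′ * fib (k ∸ j + j) + d
    eq′ = subst (λ n → fib (n + j) ≡ suc M′ * fib n + d) (sym r+j≡k) eq

append-bound : ∀ {M k m d} → 10 ≤ M → 5 ∣ M → d ≤ M ∸ 1 → fib m ≡ M * fib k + d → 7 * fib k ≤ 8 * (M ∸ 1)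
append-bound {suc M′} {k} {m} {d} 10≤M 5∣M d≤M′ eq with m ≤? 4 + k
... | yes m≤4+k = subst (λ F → 7 * F ≤ 8 * M′) (sym (short-jump 10≤M m≤4+k eq)) z≤n
... | no m≰4+k = jump-bound {k = k} 10≤M 5∣M d≤M′ 5≤j (subst (λ n → fib n ≡ suc M′ * fib k + d) (sym k+j≡m) eq)
  where
    5+k≤m : 5 + k ≤ m
    5+k≤m = ≰⇒> m≰4+k
    k+j≡m : k + (m ∸ k) ≡ m
    k+j≡m = m+[n∸m]≡n (≤-trans (m≤n+m k 5) 5+k≤m)
    5≤j : 5 ≤ m ∸ k
    5≤j = subst (_≤ m ∸ k) (m+n∸n≡m 5 k) (∸-monoˡ-≤ k 5+k≤m)

10≤10^[1+n] : ∀ n → 10 ≤ 10 ^ suc n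
10≤10^[1+n] n = *-monoʳ-≤ 10 (m^n>0 10 n)

5∣10^[1+n] : ∀ n → 5 ∣ 10 ^ suc n
5∣10^[1+n] n = ∣-trans (divides 2 refl) (m∣m*n (10 ^ n))

increasing⇒n≤f[n] : ∀ {f : ℕ → ℕ} → (∀ n → f n < f (suc n)) → ∀ n → n ≤ f n
increasing⇒n≤f[n] f[n]<f[1+n] zero = z≤n
increasing⇒n≤f[n] f[n]<f[1+n] (suc n) = ≤-<-trans (increasing⇒n≤f[n] f[n]<f[1+n] n) (f[n]<f[1+n] n)

lemma2p4 : (N : ℕ) → 1 ≤ N →
    ((F : ℕ) → IsFib F →
    (∃ λ d → d ≤ 10 ^ N ∸ 1 × IsFib (10 ^ N * F + d)) →
    7 * F ≤ 8 * (10 ^ N ∸ 1))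
    × ¬ (∃ λ (a : ℕ → ℕ) → ((i : ℕ) → IsFib (a i) × 1 ≤ a i
    × ∃ λ d → d ≤ 10 ^ N ∸ 1 × a (suc i) ≡ 10 ^ N * a i + d))
lemma2p4 (suc n) _ = bound , no-walk
  where
    M = 10 ^ suc n
    bound : (F : ℕ) → IsFib F → (∃ λ d → d ≤ M ∸ 1 × IsFib (M * F + d)) → 7 * F ≤ 8 * (M ∸ 1)
    bound _ (k , refl) (d , d≤M-1 , m , eq) = append-bound {k = k} {m = m} (10≤10^[1+n] n) (5∣10^[1+n] n) d≤M-1 eq
    no-walk : ¬ (∃ λ (a : ℕ → ℕ) → ((i : ℕ) → IsFib (a i) × 1 ≤ a i
                × ∃ λ d → d ≤ M ∸ 1 × a (suc i) ≡ M * a i + d))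
    no-walk (a , walk) = <⇒≱ (increasing⇒n≤f[n] increasing (suc B)) (≤-trans (m≤n*m _ 7) (bounded (suc B)))
      where
        B = 8 * (M ∸ 1)
        bounded : ∀ i → 7 * a i ≤ B
        bounded i with walk i
        ... | a[i]-fib , _ , d , d≤M-1 , eq = bound (a i) a[i]-fib (d , d≤M-1 , subst IsFib eq (proj₁ (walk (suc i))))
        increasing : ∀ i → a i < a (suc i)
        increasing i with walk i
        ... | _ , 1≤a[i] , d , _ , eq = begin-strict
          a i          <⟨ m<m*n (a i) M {{>-nonZero 1≤a[i]}} (≤-trans (s≤s (s≤s z≤n)) (10≤10^[1+n] n)) ⟩
          a i * M      ≡⟨ *-comm (a i) M ⟩
          M * a i      ≤⟨ m≤m+n _ d ⟩
          M * a i + d  ≡⟨ eq ⟨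
          a (suc i)    ∎
          where open ≤-Reasoning
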